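{- Let $d\ge 3$ be odd, let $\alpha\in\{0,1\}^d$ with $\alpha[1]=\alpha[d]=1$, and let $\beta\in\{0,1\}^d$ with $\beta[1]=\beta[d]=0$. Let $a^\perp$ be the vector gadget of $\alpha$ and let $b$ be the vector gadget of $\beta$ with index $j$ (for either parity of $j$). Then $\mathcal{L}(a^\perp)\cap\mathcal{L}(b)\neq\emptyset$ (equivalently, the string $b$ belongs to $\mathcal{L}(a^\perp)$) if and only if $\sum_{k=1}^d\alpha[k]\beta[k]=0$.
   Context: Alphabet $\{x,y\}$; $c^+$ denotes one or more copies of letter $c$ and $\mathcal{L}(\cdot)$ the language of a regular expression. For $v\in\{0,1\}$ and $k\in[d]$ define $C_A(v,k)$ to be $yyy^+$ if $v=1$ and $k$ odd; $xxx^+$ if $v=1$ and $k$ even; $y^+$ if $v=0$ and $k$ odd; $x^+$ if $v=0$ and $k$ even. Define $C_B(v,k)$ to be the string $y$ if $v=1$, $k$ odd; $x$ if $v=1$, $k$ even; $yyy$ if $v=0$, $k$ odd; $xxx$ if $v=0$, $k$ even. The vector gadget of $\alpha$ is the regular expression $a^\perp=C_A(\alpha[1],1)C_A(\alpha[2],2)\cdots C_A(\alpha[d],d)$. The vector gadget of $\beta$ with index $j$ is the string $b=C_B(\beta[1],1)\cdots C_B(\beta[d],d)$ if $j$ is odd and $b=yyy\,C_B(\beta[1],1)\cdots C_B(\beta[d],d)\,yyy$ if $j$ is even. -}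

module Defs where

open import Data.Bool using (Bool; true; false; if_then_else_; _∧_)
open import Data.Nat using (ℕ; zero; suc; _+_)
open import Data.List using (List; []; _∷_; _++_; replicate)
open import Data.Vec using (Vec; []; _∷_)

data Letter : Set where
  x y : Letter

Word : Set
Word = List Letter

data Regex : Set where
  ε    : Regex
  chr  : Letter → Regex
  _·_  : Regex → Regex → Regex
  _⁺   : Letter → Regex

infixr 5 _·_

data _∈L_ : Word → Regex → Set where
  ε∈   : [] ∈L ε
  chr∈ : ∀ {c} → (c ∷ []) ∈L chr c
  ·∈   : ∀ {u v r s} → u ∈L r → v ∈L s → (u ++ v) ∈L (r · s)
  ⁺∈   : ∀ {c} (n : ℕ) → replicate (suc n) c ∈L (c ⁺)

odd? : ℕ → Bool
odd? zero          = false
odd? (suc zero)    = true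
odd? (suc (suc n)) = odd? n

letterAt : ℕ → Letter
letterAt k = if odd? k then y else x

CA : Bool → ℕ → Regex
CA true  k = chr (letterAt k) · chr (letterAt k) · (letterAt k ⁺)
CA false k = letterAt k ⁺

CB : Bool → ℕ → Word
CB true  k = letterAt k ∷ []
CB false k = letterAt k ∷ letterAt k ∷ letterAt k ∷ []

gadgetAFrom : ∀ {n} → ℕ → Vec Bool n → Regex
gadgetAFrom k []       = ε
gadgetAFrom k (v ∷ vs) = CA v k · gadgetAFrom (suc k) vs

gadgetBFrom : ∀ {n} → ℕ → Vec Bool n → Word
gadgetBFrom k []       = []
gadgetBFrom k (v ∷ vs) = CB v k ++ gadgetBFrom (suc k) vs

vecGadgetA : ∀ {d} → Vec Bool d → Regex
vecGadgetA α = gadgetAFrom 1 α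

vecGadgetB : ∀ {d} → Vec Bool d → ℕ → Word
vecGadgetB β j = if odd? j then core
                 else (y ∷ y ∷ y ∷ []) ++ core ++ (y ∷ y ∷ y ∷ [])
  where core = gadgetBFrom 1 β

inner : ∀ {d} → Vec Bool d → Vec Bool d → ℕ
inner []       []       = 0
inner (a ∷ as) (b ∷ bs) = (if a ∧ b then 1 else 0) + inner as bs

-- A word of 𝓛(a^⊥) is a concatenation of d nonempty runs of the alternating letters y, x, y, …,
-- and since consecutive letters differ, a word built from d such runs splits into them in only
-- one way. So it lies in 𝓛(a^⊥) exactly when its k-th run has length ≥ 3 if α[k] = 1 and ≥ 1
-- if α[k] = 0. The k-th run of b has length 1 if β[k] = 1 and 3 if β[k] = 0, which fails
-- exactly when α[k] = β[k] = 1. For even j the two extra blocks yyy only lengthen the first and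
-- the last run (both of letter y since d is odd); as β[1] = β[d] = 0 these runs already have
-- length 3, which meets every threshold.
module Submission where

open import Defs
open import Data.Bool using (Bool; true; false; if_then_else_)
open import Data.Nat using (ℕ; zero; suc; _+_; _≤_; _<_; _∸_; z≤n; s≤s)
open import Data.Nat.Properties using (≤-trans; ≤-refl; m≤m+n; n≮0; +-identityʳ; +-suc)
open import Data.Fin as Fin using (Fin; toℕ; fromℕ)
open import Data.Fin.Properties using (toℕ-fromℕ)
open import Data.Vec using (Vec; []; _∷_; map; lookup)
open import Data.Vec.Properties using (lookup-map)
open import Data.Vec.Relation.Binary.Pointwise.Inductive using (Pointwise; []; _∷_)
open import Data.Vec.Relation.Unary.All using (All; []; _∷_; universal)
open import Data.Vec.Relation.Unary.All.Properties using (map⁺)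
open import Data.List using ([]; _∷_; _++_; replicate; head)
open import Data.List.Properties using (++-assoc; ++-identityʳ; ∷-injective)
open import Data.Maybe using (just)
open import Data.Maybe.Properties using (just-injective)
open import Data.Product using (∃-syntax; _×_; _,_; proj₂)
open import Data.Empty using (⊥-elim)
open import Relation.Binary.PropositionalEquality 
  using (_≡_; _≢_; refl; sym; cong; cong₂; module ≡-Reasoning)
open import Function.Base using (_∘_)
open import Function.Bundles using (_⇔_; mk⇔; Equivalence)
open import Function.Construct.Composition using (_⇔-∘_)
open import Function.Related.Propositional using (module EquationalReasoning)

letterAt-suc≢ : ∀ k → letterAt (suc k) ≢ letterAt k
letterAt-suc≢ zero ()
letterAt-suc≢ (suc zero) ()
letterAt-suc≢ (suc (suc k)) = letterAt-suc≢ k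

replicate-+ : ∀ {A : Set} m n (c : A) → replicate (m + n) c ≡ replicate m c ++ replicate n c
replicate-+ zero n c = refl
replicate-+ (suc m) n c = cong (c ∷_) (replicate-+ m n c)

replicate-++-cancel : ∀ {c : Letter} m m' {v v' : Word} → head v ≢ just c → head v' ≢ just c →
                      replicate m c ++ v ≡ replicate m' c ++ v' → m ≡ m' × v ≡ v'
replicate-++-cancel zero zero _ _ eq = refl , eq
replicate-++-cancel zero (suc m') hv _ eq = ⊥-elim (hv (cong head eq))
replicate-++-cancel (suc m) zero _ hv' eq = ⊥-elim (hv' (cong head (sym eq)))
replicate-++-cancel (suc m) (suc m') hv hv' eq
  with replicate-++-cancel m m' hv hv' (proj₂ (∷-injective eq))
... | m≡m' , v≡v' = cong suc m≡m' , v≡v'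

runsFrom : ∀ {n} → ℕ → Vec ℕ n → Word
runsFrom k []       = []
runsFrom k (m ∷ ms) = replicate m (letterAt k) ++ runsFrom (suc k) ms

head-runsFrom : ∀ {n} k (ms : Vec ℕ n) → All (0 <_) ms → head (runsFrom (suc k) ms) ≢ just (letterAt k)
head-runsFrom k [] [] ()
head-runsFrom k (suc m ∷ ms) (_ ∷ _) eq = letterAt-suc≢ k (just-injective eq)

minRun : Bool → ℕ
minRun true  = 3
minRun false = 1

RunFits : Bool → ℕ → Set
RunFits a m = minRun a ≤ m

0<minRun : ∀ a → 0 < minRun a
0<minRun true  = s≤s z≤n
0<minRun false = s≤s z≤n

minRun≤3 : ∀ a → minRun a ≤ 3
minRun≤3 true  = ≤-refl
minRun≤3 false = s≤s z≤n

replicate∈CA : ∀ {a m} k → RunFits a m → replicate m (letterAt k) ∈L CA a k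
replicate∈CA {true}  k (s≤s (s≤s (s≤s {n = m} _))) = ·∈ chr∈ (·∈ chr∈ (⁺∈ m))
replicate∈CA {false} k (s≤s {n = m} _)             = ⁺∈ m

CA-run : ∀ a k {w} → w ∈L CA a k → ∃[ m ] w ≡ replicate m (letterAt k) × RunFits a m
CA-run true  k (·∈ chr∈ (·∈ chr∈ (⁺∈ m))) = suc (suc (suc m)) , refl , s≤s (s≤s (s≤s z≤n))
CA-run false k (⁺∈ m)                     = suc m , refl , s≤s z≤n

head-gadgetAFrom : ∀ {n} k (α : Vec Bool n) {w} → w ∈L gadgetAFrom (suc k) α → head w ≢ just (letterAt k)
head-gadgetAFrom k [] ε∈ ()
head-gadgetAFrom k (a ∷ α) (·∈ u∈ _) with CA-run a (suc k) u∈
... | suc m , refl , _ = λ eq → letterAt-suc≢ k (just-injective eq)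
... | zero , refl , fits = ⊥-elim (n≮0 (≤-trans (0<minRun a) fits))

runsFrom∈gadgetAFrom : ∀ {n} k (α : Vec Bool n) (ms : Vec ℕ n) →
                       Pointwise RunFits α ms → runsFrom k ms ∈L gadgetAFrom k α
runsFrom∈gadgetAFrom k [] [] [] = ε∈
runsFrom∈gadgetAFrom k (a ∷ α) (m ∷ ms) (fits ∷ fitss) =
  ·∈ (replicate∈CA k fits) (runsFrom∈gadgetAFrom (suc k) α ms fitss)

gadgetAFrom∋runsFrom⇒fits : ∀ {n} k (α : Vec Bool n) (ms : Vec ℕ n) → All (0 <_) ms →
                            ∀ {w} → w ∈L gadgetAFrom k α → w ≡ runsFrom k ms → Pointwise RunFits α ms
gadgetAFrom∋runsFrom⇒fits k [] [] [] ε∈ _ = []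
gadgetAFrom∋runsFrom⇒fits k (a ∷ α) (m ∷ ms) (_ ∷ pos) (·∈ u∈ v∈) eq with CA-run a k u∈
... | m' , refl , fits
  with replicate-++-cancel m' m (head-gadgetAFrom k α v∈) (head-runsFrom k ms pos) eq
...   | refl , v≡ = fits ∷ gadgetAFrom∋runsFrom⇒fits (suc k) α ms pos v∈ v≡

runsFrom∈gadgetAFrom⇔ : ∀ {n} k (α : Vec Bool n) (ms : Vec ℕ n) → All (0 <_) ms →
                        runsFrom k ms ∈L gadgetAFrom k α ⇔ Pointwise RunFits α ms
runsFrom∈gadgetAFrom⇔ k α ms pos =
  mk⇔ (λ w∈ → gadgetAFrom∋runsFrom⇒fits k α ms pos w∈ refl) (runsFrom∈gadgetAFrom k α ms)

cbLen : Bool → ℕ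
cbLen true  = 1
cbLen false = 3

0<cbLen : ∀ b → 0 < cbLen b
0<cbLen true  = s≤s z≤n
0<cbLen false = s≤s z≤n

gadgetBFrom≡runsFrom : ∀ {n} k (β : Vec Bool n) → gadgetBFrom k β ≡ runsFrom k (map cbLen β)
gadgetBFrom≡runsFrom k []           = refl
gadgetBFrom≡runsFrom k (true ∷ β)   = cong (letterAt k ∷_) (gadgetBFrom≡runsFrom (suc k) β)
gadgetBFrom≡runsFrom k (false ∷ β)  =
  cong (λ w → letterAt k ∷ letterAt k ∷ letterAt k ∷ w) (gadgetBFrom≡runsFrom (suc k) β)

fits-∷⇔ : ∀ {n a m} {α : Vec Bool n} {ms : Vec ℕ n} → RunFits a m →
          Pointwise RunFits (a ∷ α) (m ∷ ms) ⇔ Pointwise RunFits α ms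
fits-∷⇔ fits = mk⇔ (λ { (_ ∷ fitss) → fitss }) (fits ∷_)

fits-cbLen⇔inner≡0 : ∀ {n} (α β : Vec Bool n) → Pointwise RunFits α (map cbLen β) ⇔ inner α β ≡ 0
fits-cbLen⇔inner≡0 []          []          = mk⇔ (λ _ → refl) (λ _ → [])
fits-cbLen⇔inner≡0 (true ∷ α)  (true ∷ β)  = mk⇔ (λ { (s≤s () ∷ _) }) (λ ())
fits-cbLen⇔inner≡0 (true ∷ α)  (false ∷ β) = fits-cbLen⇔inner≡0 α β ⇔-∘ fits-∷⇔ ≤-refl
fits-cbLen⇔inner≡0 (false ∷ α) (b ∷ β)     = fits-cbLen⇔inner≡0 α β ⇔-∘ fits-∷⇔ (0<cbLen b)

padLast : ∀ {n} → ℕ → Vec ℕ (suc n) → Vec ℕ (suc n)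
padLast p (m ∷ [])     = m + p ∷ []
padLast p (m ∷ m' ∷ ms) = m ∷ padLast p (m' ∷ ms)

runsFrom-padLast : ∀ {n} k p (ms : Vec ℕ (suc n)) →
                   runsFrom k (padLast p ms) ≡ runsFrom k ms ++ replicate p (letterAt (k + n))
runsFrom-padLast {zero} k p (m ∷ []) = begin
  replicate (m + p) c ++ []       ≡⟨ ++-identityʳ _ ⟩
  replicate (m + p) c             ≡⟨ replicate-+ m p c ⟩
  replicate m c ++ replicate p c  ≡⟨ cong₂ _++_ (sym (++-identityʳ _)) (cong (replicate p ∘ letterAt) (sym (+-identityʳ k))) ⟩
  (replicate m c ++ []) ++ replicate p (letterAt (k + 0))  ∎
  where open ≡-Reasoning
        c : Letter
        c = letterAt k
runsFrom-padLast {suc n} k p (m ∷ m' ∷ ms) = begin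
  run ++ runsFrom (suc k) (padLast p (m' ∷ ms))
    ≡⟨ cong (run ++_) (runsFrom-padLast (suc k) p (m' ∷ ms)) ⟩
  run ++ (runsFrom (suc k) (m' ∷ ms) ++ replicate p (letterAt (suc k + n)))
    ≡⟨ sym (++-assoc run _ _) ⟩
  runsFrom k (m ∷ m' ∷ ms) ++ replicate p (letterAt (suc k + n))
    ≡⟨ cong (λ i → runsFrom k (m ∷ m' ∷ ms) ++ replicate p (letterAt i)) (sym (+-suc k n)) ⟩
  runsFrom k (m ∷ m' ∷ ms) ++ replicate p (letterAt (k + suc n))
    ∎
  where open ≡-Reasoning
        run : Word
        run = replicate m (letterAt k)

gadgetBFrom-++-padLast : ∀ {n} k p (β : Vec Bool (suc n)) →
                         gadgetBFrom k β ++ replicate p (letterAt (k + n)) ≡ runsFrom k (padLast p (map cbLen β))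
gadgetBFrom-++-padLast {n} k p β = begin
  gadgetBFrom k β ++ padding           ≡⟨ cong (_++ padding) (gadgetBFrom≡runsFrom k β) ⟩
  runsFrom k (map cbLen β) ++ padding  ≡⟨ sym (runsFrom-padLast k p (map cbLen β)) ⟩
  runsFrom k (padLast p (map cbLen β)) ∎
  where open ≡-Reasoning
        padding : Word
        padding = replicate p (letterAt (k + n))

0<padLast : ∀ {n} p (ms : Vec ℕ (suc n)) → All (0 <_) ms → All (0 <_) (padLast p ms)
0<padLast p (m ∷ [])      (0<m ∷ [])  = ≤-trans 0<m (m≤m+n m p) ∷ []
0<padLast p (m ∷ m' ∷ ms) (0<m ∷ pos) = 0<m ∷ 0<padLast p (m' ∷ ms) pos

fits-padLast⇔ : ∀ {n} p (α : Vec Bool (suc n)) (ms : Vec ℕ (suc n)) → 3 ≤ lookup ms (fromℕ n) →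
                Pointwise RunFits α (padLast p ms) ⇔ Pointwise RunFits α ms
fits-padLast⇔ p (a ∷ []) (m ∷ []) 3≤m =
  mk⇔ (λ _ → fits ∷ []) (λ _ → ≤-trans fits (m≤m+n m p) ∷ [])
  where fits : RunFits a m
        fits = ≤-trans (minRun≤3 a) 3≤m
fits-padLast⇔ p (a ∷ α) (m ∷ m' ∷ ms) 3≤last =
  mk⇔ (λ { (fits ∷ fitss) → fits ∷ to fitss }) (λ { (fits ∷ fitss) → fits ∷ from fitss })
  where open Equivalence (fits-padLast⇔ p α (m' ∷ ms) 3≤last)

lemma1 : (d : ℕ) → 3 ≤ d → odd? d ≡ true →
         (α β : Vec Bool d) →
         (∀ (i : Fin d) → toℕ i ≡ 0 → lookup α i ≡ true) →
         (∀ (i : Fin d) → toℕ i ≡ d ∸ 1 → lookup α i ≡ true) →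
         (∀ (i : Fin d) → toℕ i ≡ 0 → lookup β i ≡ false) →
         (∀ (i : Fin d) → toℕ i ≡ d ∸ 1 → lookup β i ≡ false) →
         (j : ℕ) →
         (vecGadgetB β j ∈L vecGadgetA α) ⇔ (inner α β ≡ 0)
lemma1 (suc zero) (s≤s ()) _ _ _ _ _ _ _ _
lemma1 (suc (suc (suc n))) _ odd-d α@(_ ∷ α') (_ ∷ β) hα₀ _ hβ₀ hβₗ j
  with odd? j | hβ₀ Fin.zero refl
... | true | refl = begin
  gadgetBFrom 1 (false ∷ β) ∈L vecGadgetA α
    ≡⟨ cong (_∈L vecGadgetA α) (gadgetBFrom≡runsFrom 1 (false ∷ β)) ⟩
  runsFrom 1 (map cbLen (false ∷ β)) ∈L vecGadgetA α
    ∼⟨ runsFrom∈gadgetAFrom⇔ 1 α _ (map⁺ (universal 0<cbLen (false ∷ β))) ⟩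
  Pointwise RunFits α (map cbLen (false ∷ β))
    ∼⟨ fits-cbLen⇔inner≡0 α (false ∷ β) ⟩
  inner α (false ∷ β) ≡ 0
    ∎
  where open EquationalReasoning
... | false | refl with hα₀ Fin.zero refl
...   | refl = begin
  (yyy ++ yyy ++ gadgetBFrom 2 β ++ yyy) ∈L vecGadgetA α
    ≡⟨ cong (λ c → (yyy ++ yyy ++ gadgetBFrom 2 β ++ replicate 3 c) ∈L vecGadgetA α) (sym letterAt-d) ⟩
  (yyy ++ yyy ++ gadgetBFrom 2 β ++ replicate 3 (letterAt (3 + n))) ∈L vecGadgetA α
    ≡⟨ cong (λ w → (yyy ++ yyy ++ w) ∈L vecGadgetA α) (gadgetBFrom-++-padLast 2 3 β) ⟩
  runsFrom 1 (6 ∷ padded) ∈L vecGadgetA α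
    ∼⟨ runsFrom∈gadgetAFrom⇔ 1 α (6 ∷ padded) (s≤s z≤n ∷ 0<padLast 3 lens (map⁺ (universal 0<cbLen β))) ⟩
  Pointwise RunFits α (6 ∷ padded)
    ∼⟨ fits-∷⇔ (s≤s (s≤s (s≤s z≤n))) ⟩
  Pointwise RunFits α' padded
    ∼⟨ fits-padLast⇔ 3 α' lens 3≤last ⟩
  Pointwise RunFits α' lens
    ∼⟨ fits-cbLen⇔inner≡0 α' β ⟩
  inner α (false ∷ β) ≡ 0
    ∎
  where
  open EquationalReasoning
  yyy : Word
  yyy = replicate 3 y
  lens padded : Vec ℕ (2 + n)
  lens = map cbLen β
  padded = padLast 3 lens
  letterAt-d : letterAt (3 + n) ≡ y
  letterAt-d = cong (if_then y else x) odd-d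
  3≤last : 3 ≤ lookup lens (fromℕ (suc n))
  3≤last rewrite lookup-map (fromℕ (suc n)) cbLen β | hβₗ (fromℕ (2 + n)) (toℕ-fromℕ _) = ≤-refl
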